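{- Let $G$ be a finite simple graph with a proper edge coloring $\kappa:E(G)\to[k]$. The coloring group $\mathfrak{G}_\kappa$ is imprimitive if and only if there exists an imprimitive vertex coloring of $G$ with respect to $\kappa$.
   Context: A proper edge coloring of $G$ on $k$ colors is a surjective map $\kappa:E(G)\to[k]$ such that edges sharing a vertex receive different colors. For $a\in[k]$, $\tau_a\in S_{V(G)}$ is the product of the transpositions $(i,j)$ over all edges $\{i,j\}$ colored $a$, and the coloring group $\mathfrak{G}_\kappa\le S_{V(G)}$ is generated by $\tau_1,\dots,\tau_k$. A permutation group on a finite set $X$ is called imprimitive if it fixes (under its natural action on set partitions of $X$) some nontrivial set partition of $X$, i.e. one that is neither the partition with a single block nor the partition into singletons; otherwise it is primitive. A vertex coloring $\nu:V(G)\to[\ell]$ is imprimitive (with respect to $\kappa$) if: (i) whenever an edge colored $b$ connects a vertex with $\nu$-color $a$ to a vertex with $\nu$-color $c$ where $a\neq c$, every vertex with $\nu$-color $a$ is connected to some vertex with $\nu$-color $c$ by an edge colored $b$; and (ii) at least one $\nu$-color appears strictly more than one time and strictly fewer than $|V(G)|$ times. -}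

module Defs where

open import Data.Nat using (ℕ; _<_)
open import Data.Fin using (Fin; _<?_; _≟_)
open import Data.Fin.Permutation using (Permutation′; transpose; id; flip; _∘ₚ_; _⟨$⟩ʳ_)
open import Data.Bool using (Bool; true; false; _∧_)
open import Data.Maybe using (Maybe; just; nothing)
open import Data.List using (List; []; _∷_; foldr; filter; filterᵇ; allFin; cartesianProduct; length)
open import Data.Product using (Σ; ∃; ∃-syntax; _×_; _,_)
open import Relation.Binary.PropositionalEquality using (_≡_; _≢_)
open import Relation.Nullary using (¬_)
open import Relation.Nullary.Decidable using (⌊_⌋)
open import Function.Bundles using (_⇔_)

-- A finite simple graph on the vertex set Fin n together with a proper edge
-- coloring κ : E(G) → [k] (colors are Fin k), encoded as a symmetric matrix:
-- col i j ≡ just a  iff  {i,j} is an edge of G and κ {i,j} = a;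
-- col i j ≡ nothing iff  {i,j} is not an edge.
record EdgeColoredGraph (n k : ℕ) : Set where
  field
    col     : Fin n → Fin n → Maybe (Fin k)
    loopless : ∀ i → col i i ≡ nothing
    symm    : ∀ i j → col i j ≡ col j i
    proper  : ∀ i j l a → col i j ≡ just a → col i l ≡ just a → j ≡ l
    surj    : ∀ a → ∃[ i ] ∃[ j ] col i j ≡ just a

module _ {n k : ℕ} (G : EdgeColoredGraph n k) where
  open EdgeColoredGraph G

  hasColor : Maybe (Fin k) → Fin k → Bool
  hasColor nothing  a = false
  hasColor (just b) a = ⌊ b ≟ a ⌋

  edgesOfColor : Fin k → List (Fin n × Fin n)
  edgesOfColor a = filterᵇ (λ { (i , j) → ⌊ i <? j ⌋ ∧ hasColor (col i j) a })
                           (cartesianProduct (allFin n) (allFin n))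

  τ : Fin k → Permutation′ n
  τ a = foldr (λ { (i , j) p → transpose i j ∘ₚ p }) id (edgesOfColor a)

  evalWord : List (Fin k × Bool) → Permutation′ n
  evalWord []                = id
  evalWord ((a , false) ∷ w) = τ a ∘ₚ evalWord w
  evalWord ((a , true)  ∷ w) = flip (τ a) ∘ₚ evalWord w

  -- membership in the coloring group 𝔊_κ = ⟨τ_1, …, τ_k⟩ ≤ S_{V(G)}
  InColoringGroup : Permutation′ n → Set
  InColoringGroup g = ∃[ w ] (∀ x → g ⟨$⟩ʳ x ≡ evalWord w ⟨$⟩ʳ x)

-- A set partition of Fin n, given by a block-labelling (blocks are the fibres).
SetPartition : ℕ → Set
SetPartition n = Fin n → Fin n

SameBlock : ∀ {n} → SetPartition n → Fin n → Fin n → Set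
SameBlock P x y = P x ≡ P y

Fixes : ∀ {n} → Permutation′ n → SetPartition n → Set
Fixes g P = ∀ x y → SameBlock P x y ⇔ SameBlock P (g ⟨$⟩ʳ x) (g ⟨$⟩ʳ y)

Nontrivial : ∀ {n} → SetPartition n → Set
Nontrivial {n} P = ¬ (∀ x y → SameBlock P x y) × ¬ (∀ x y → SameBlock P x y → x ≡ y)

Imprimitive : ∀ {n} → (Permutation′ n → Set) → Set
Imprimitive {n} H = Σ (SetPartition n) λ P → Nontrivial P × (∀ g → H g → Fixes g P)

count : ∀ {n ℓ} → (Fin n → Fin ℓ) → Fin ℓ → ℕ
count {n} ν a = length (filter (λ x → ν x ≟ a) (allFin n))

IsImprimitiveVertexColoring : ∀ {n k} → EdgeColoredGraph n k → (ℓ : ℕ) → (Fin n → Fin ℓ) → Set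
IsImprimitiveVertexColoring {n} {k} G ℓ ν =
  (∀ (a c : Fin ℓ) (b : Fin k) → a ≢ c →
     (∃[ u ] ∃[ v ] (ν u ≡ a × ν v ≡ c × col u v ≡ just b)) →
     ∀ u → ν u ≡ a → ∃[ v ] (ν v ≡ c × col u v ≡ just b))
  × (∃[ a ] (1 < count ν a × count ν a < n))
  where open EdgeColoredGraph G

{-# OPTIONS --safe #-}
module Submission where

-- The generator τ_b is the involution swapping the two endpoints of every
-- b-colored edge, since these edges form a matching. Hence a partition is
-- fixed by τ_b exactly when, as soon as one block A has a b-edge into a
-- different block C, every vertex of A has its b-neighbour in C: the block
-- labelling of a fixed partition is an imprimitive vertex coloring, and the
-- classes of an imprimitive vertex coloring form a partition fixed by every
-- τ_b, hence by the whole group. Nontriviality of the partition corresponds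
-- to a class of size strictly between 1 and n.

open import Defs
open import Data.Nat using (ℕ; _<_; s≤s)
open import Data.Nat.Properties using (m<n⇒m<1+n; <-irrefl)
open import Data.Fin using (Fin; _≟_; _<?_) renaming (_<_ to _<ᶠ_)
open import Data.Fin.Properties using (<-cmp; <-asym; ¬∀⟶∃¬; any?; all?)
open import Data.Fin.Permutation using (Permutation′; transpose; id; flip; _∘ₚ_; _⟨$⟩ʳ_; _⟨$⟩ˡ_; inverseʳ)
import Data.Fin.Permutation.Components as PC
open import Data.Bool using (T; _∧_; false; true)
open import Data.Bool.Properties using (T-∧)
open import Data.Maybe using (just; nothing)
open import Data.List using (List; []; _∷_; foldr; filter; allFin; cartesianProduct; length)
open import Data.List.Properties using (filter-notAll; filter-all; length-tabulate)
open import Data.List.Relation.Unary.Any as Any using (Any; here; there)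
open import Data.List.Relation.Unary.All as All using (All; []; _∷_)
open import Data.List.Relation.Unary.All.Properties using (All¬⇒¬Any)
open import Data.List.Relation.Unary.AllPairs using (AllPairs; []; _∷_)
open import Data.List.Relation.Unary.Unique.Propositional using (Unique)
open import Data.List.Relation.Unary.Unique.Propositional.Properties using (filter⁺; cartesianProduct⁺; allFin⁺)
open import Data.List.Membership.Propositional using (_∈_)
open import Data.List.Membership.Propositional.Properties using (∈-length; ∈-filter⁺; ∈-filter⁻; ∈-cartesianProduct⁺; ∈-allFin)
open import Data.Product using (Σ; ∃-syntax; _×_; _,_; proj₁; proj₂)
open import Data.Product.Function.NonDependent.Propositional using (_×-⇔_)
open import Data.Sum using (_⊎_; inj₁; inj₂)
open import Data.Empty using (⊥-elim)
open import Function using (_∘_)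
open import Function.Bundles using (_⇔_; mk⇔; Equivalence)
import Function.Properties.Equivalence as ⇔
open import Relation.Binary.Definitions using (tri<; tri≈; tri>)
open import Relation.Binary.PropositionalEquality using (_≡_; _≢_; refl; sym; trans; cong; subst; subst₂)
open import Relation.Nullary using (¬_; yes; no)
open import Relation.Nullary.Decidable using (Dec; ⌊_⌋; toWitness; fromWitness; dec-true; dec-false; _⊎-dec_; _→-dec_)

private
  variable
    n m ℓ : ℕ

module _ (i j : Fin n) where

  transpose-left : PC.transpose i j i ≡ j
  transpose-left rewrite dec-true (i ≟ i) refl = refl

  transpose-right : PC.transpose i j j ≡ i
  transpose-right with j ≟ i
  ... | yes j≡i = j≡i
  ... | no _ rewrite dec-true (j ≟ j) refl = refl

  transpose-other : ∀ {x} → i ≢ x → j ≢ x → PC.transpose i j x ≡ x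
  transpose-other {x} i≢x j≢x
    rewrite dec-false (x ≟ i) (i≢x ∘ sym) | dec-false (x ≟ j) (j≢x ∘ sym) = refl

Incident : Fin n → Fin n × Fin n → Set
Incident x (i , j) = i ≡ x ⊎ j ≡ x

incident? : (x : Fin n) (e : Fin n × Fin n) → Dec (Incident x e)
incident? x (i , j) = (i ≟ x) ⊎-dec (j ≟ x)

Joins : Fin n → Fin n → Fin n × Fin n → Set
Joins x y (i , j) = (i ≡ x × j ≡ y) ⊎ (j ≡ x × i ≡ y)

joins⇒incident : ∀ {x y : Fin n} {e} → Joins x y e → Incident x e
joins⇒incident (inj₁ (i≡x , _)) = inj₁ i≡x
joins⇒incident (inj₂ (j≡x , _)) = inj₂ j≡x

incident⇒joins : ∀ {x : Fin n} {e} → Incident x e → ∃[ y ] Joins x y e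
incident⇒joins {e = i , j} (inj₁ refl) = j , inj₁ (refl , refl)
incident⇒joins {e = i , j} (inj₂ refl) = i , inj₂ (refl , refl)

Disjoint : Fin n × Fin n → Fin n × Fin n → Set
Disjoint e e′ = ∀ {x} → Incident x e → ¬ Incident x e′

product : List (Fin n × Fin n) → Permutation′ n
product = foldr (λ e π → transpose (proj₁ e) (proj₂ e) ∘ₚ π) id

disjoint⇒¬incident : ∀ {e} {L : List (Fin n × Fin n)} {x} →
                     All (Disjoint e) L → Incident x e → ¬ Any (Incident x) L
disjoint⇒¬incident disjoint x∈e = All¬⇒¬Any (All.map (λ d → d x∈e) disjoint)

product-fixes : ∀ (L : List (Fin n × Fin n)) {x} → ¬ Any (Incident x) L → product L ⟨$⟩ʳ x ≡ x
product-fixes []            _   = refl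
product-fixes ((i , j) ∷ L) ¬x∈ = trans
  (cong (product L ⟨$⟩ʳ_) (transpose-other i j (¬x∈ ∘ here ∘ inj₁) (¬x∈ ∘ here ∘ inj₂)))
  (product-fixes L (¬x∈ ∘ there))

product-swaps : ∀ {L : List (Fin n × Fin n)} → AllPairs Disjoint L →
                ∀ {x} → Any (Incident x) L → Any (Joins x (product L ⟨$⟩ʳ x)) L
product-swaps {L = (i , j) ∷ L} (disjoint ∷ _) (here (inj₁ refl)) = here (inj₁ (refl , sym (
  trans (cong (product L ⟨$⟩ʳ_) (transpose-left i j))
        (product-fixes L (disjoint⇒¬incident disjoint (inj₂ refl))))))
product-swaps {L = (i , j) ∷ L} (disjoint ∷ _) (here (inj₂ refl)) = here (inj₂ (refl , sym (
  trans (cong (product L ⟨$⟩ʳ_) (transpose-right i j))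
        (product-fixes L (disjoint⇒¬incident disjoint (inj₁ refl))))))
product-swaps {L = (i , j) ∷ L} (disjoint ∷ matching) {x} (there x∈L) =
  there (subst (λ y → Any (Joins x y) L) (sym fixed) (product-swaps matching x∈L))
  where
  x∉e : ¬ Incident x (i , j)
  x∉e x∈e = disjoint⇒¬incident disjoint x∈e x∈L
  fixed : product ((i , j) ∷ L) ⟨$⟩ʳ x ≡ product L ⟨$⟩ʳ x
  fixed = cong (product L ⟨$⟩ʳ_) (transpose-other i j (x∉e ∘ inj₁) (x∉e ∘ inj₂))

module ColorClass {k} (G : EdgeColoredGraph n k) (b : Fin k) where
  open EdgeColoredGraph G

  IsEdgeOfColor : Fin n × Fin n → Set
  IsEdgeOfColor (i , j) = i <ᶠ j × col i j ≡ just b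

  col-sym : ∀ {x y} → col x y ≡ just b → col y x ≡ just b
  col-sym {x} {y} = trans (symm y x)

  T-hasColor : ∀ c → T (hasColor G c b) ⇔ c ≡ just b
  T-hasColor nothing  = mk⇔ (λ ()) (λ ())
  T-hasColor (just a) = mk⇔ (cong just ∘ toWitness) (λ { refl → fromWitness refl })

  T-edgeOfColor : ∀ i j → T (⌊ i <? j ⌋ ∧ hasColor G (col i j) b) ⇔ IsEdgeOfColor (i , j)
  T-edgeOfColor i j = ⇔.trans T-∧ (mk⇔ toWitness fromWitness ×-⇔ T-hasColor (col i j))

  ∈-edgesOfColor⁻ : All IsEdgeOfColor (edgesOfColor G b)
  ∈-edgesOfColor⁻ = All.tabulate λ {(i , j)} e∈ →
    Equivalence.to (T-edgeOfColor i j) (proj₂ (∈-filter⁻ _ {xs = cartesianProduct (allFin n) (allFin n)} e∈))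

  ∈-edgesOfColor⁺ : ∀ {i j} → IsEdgeOfColor (i , j) → (i , j) ∈ edgesOfColor G b
  ∈-edgesOfColor⁺ {i} {j} e = ∈-filter⁺ _ (∈-cartesianProduct⁺ (∈-allFin i) (∈-allFin j))
                                          (Equivalence.from (T-edgeOfColor i j) e)

  edgesOfColor-unique : Unique (edgesOfColor G b)
  edgesOfColor-unique = filter⁺ _ (cartesianProduct⁺ (allFin⁺ n) (allFin⁺ n))

  joins-colored : ∀ {x y e} → IsEdgeOfColor e → Joins x y e → col x y ≡ just b
  joins-colored (_ , c) (inj₁ (refl , refl)) = c
  joins-colored (_ , c) (inj₂ (refl , refl)) = col-sym c

  joins-unique : ∀ {x y e e′} → IsEdgeOfColor e → IsEdgeOfColor e′ → Joins x y e → Joins x y e′ → e ≡ e′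
  joins-unique _         _         (inj₁ (refl , refl)) (inj₁ (refl , refl)) = refl
  joins-unique (i<j , _) (j<i , _) (inj₁ (refl , refl)) (inj₂ (refl , refl)) = ⊥-elim (<-asym i<j j<i)
  joins-unique (j<i , _) (i<j , _) (inj₂ (refl , refl)) (inj₁ (refl , refl)) = ⊥-elim (<-asym i<j j<i)
  joins-unique _         _         (inj₂ (refl , refl)) (inj₂ (refl , refl)) = refl

  -- By properness both edges join x to the same b-neighbour.
  sharedEndpoint⇒equal : ∀ {x e e′} → IsEdgeOfColor e → IsEdgeOfColor e′ → Incident x e → Incident x e′ → e ≡ e′
  sharedEndpoint⇒equal {x} c c′ x∈e x∈e′ with incident⇒joins x∈e | incident⇒joins x∈e′
  ... | y , joins | y′ , joins′ with proper x y y′ b (joins-colored c joins) (joins-colored c′ joins′)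
  ...   | refl = joins-unique c c′ joins joins′

  distinct⇒disjoint : ∀ {L} → AllPairs _≢_ L → All IsEdgeOfColor L → AllPairs Disjoint L
  distinct⇒disjoint []                     []       = []
  distinct⇒disjoint (distinct ∷ distincts) (c ∷ cs) =
    All.zipWith (λ (e≢e′ , c′) {_} x∈e x∈e′ → e≢e′ (sharedEndpoint⇒equal c c′ x∈e x∈e′)) (distinct , cs)
    ∷ distinct⇒disjoint distincts cs

  edgesOfColor-matching : AllPairs Disjoint (edgesOfColor G b)
  edgesOfColor-matching = distinct⇒disjoint edgesOfColor-unique ∈-edgesOfColor⁻

  edge⇒joins : ∀ {x y} → col x y ≡ just b → Any (Joins x y) (edgesOfColor G b)
  edge⇒joins {x} {y} c with <-cmp x y
  ... | tri< x<y _ _ = Any.map (λ { refl → inj₁ (refl , refl) }) (∈-edgesOfColor⁺ (x<y , c))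
  ... | tri> _ _ y<x = Any.map (λ { refl → inj₂ (refl , refl) }) (∈-edgesOfColor⁺ (y<x , col-sym c))
  ... | tri≈ _ refl _ with trans (sym (loopless x)) c
  ...   | ()

  -- τ G b unfolds to product (edgesOfColor G b), so the matching lemmas apply to it.
  τb : Fin n → Fin n
  τb x = τ G b ⟨$⟩ʳ x

  τ-colored : ∀ {x} → Any (Incident x) (edgesOfColor G b) → col x (τb x) ≡ just b
  τ-colored x∈ = All.lookupWith joins-colored ∈-edgesOfColor⁻
                                 (product-swaps edgesOfColor-matching x∈)

  τ-along-edge : ∀ {x y} → col x y ≡ just b → τb x ≡ y
  τ-along-edge {x} {y} c = proper x (τb x) y b (τ-colored (Any.map joins⇒incident (edge⇒joins c))) c

  τ-moved : ∀ {x} → τb x ≢ x → col x (τb x) ≡ just b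
  τ-moved {x} moved with Any.any? (incident? x) (edgesOfColor G b)
  ... | yes x∈ = τ-colored x∈
  ... | no  x∉ = ⊥-elim (moved (product-fixes (edgesOfColor G b) x∉))

  τ-involutive : ∀ x → τb (τb x) ≡ x
  τ-involutive x with τb x ≟ x
  ... | yes fixed = trans (cong τb fixed) fixed
  ... | no  moved = τ-along-edge (col-sym (τ-moved moved))

module _ {A : Set} where

  1<length : ∀ {x y : A} {xs} → x ∈ xs → y ∈ xs → x ≢ y → 1 < length xs
  1<length (here refl) (here refl) x≢y = ⊥-elim (x≢y refl)
  1<length (here _)    (there y∈)  _   = s≤s (∈-length y∈)
  1<length (there x∈)  (here _)    _   = s≤s (∈-length x∈)
  1<length (there x∈)  (there y∈)  x≢y = m<n⇒m<1+n (1<length x∈ y∈ x≢y)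

  1<length⇒distinct : ∀ {xs : List A} → Unique xs → 1 < length xs →
                      ∃[ x ] ∃[ y ] (x ∈ xs × y ∈ xs × x ≢ y)
  1<length⇒distinct {_ ∷ []}    _                   (s≤s ())
  1<length⇒distinct {u ∷ v ∷ _} ((u≢v ∷ _) ∷ _) _ = u , v , here refl , there (here refl) , u≢v

module _ (ν : Fin n → Fin ℓ) (a : Fin ℓ) where

  1<count⇔ : 1 < count ν a ⇔ (∃[ x ] ∃[ y ] (x ≢ y × ν x ≡ a × ν y ≡ a))
  1<count⇔ = mk⇔ distinct (λ (x , y , x≢y , νx , νy) → 1<length (member νx) (member νy) x≢y)
    where
    member : ∀ {x} → ν x ≡ a → x ∈ filter (λ x → ν x ≟ a) (allFin n)
    member {x} = ∈-filter⁺ (λ x → ν x ≟ a) (∈-allFin x)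
    colored : ∀ {x} → x ∈ filter (λ x → ν x ≟ a) (allFin n) → ν x ≡ a
    colored = proj₂ ∘ ∈-filter⁻ (λ x → ν x ≟ a) {xs = allFin n}
    distinct : 1 < count ν a → ∃[ x ] ∃[ y ] (x ≢ y × ν x ≡ a × ν y ≡ a)
    distinct 1<c with 1<length⇒distinct (filter⁺ (λ x → ν x ≟ a) (allFin⁺ n)) 1<c
    ... | x , y , x∈ , y∈ , x≢y = x , y , x≢y , colored x∈ , colored y∈

  count<n⇔ : count ν a < n ⇔ (∃[ z ] ν z ≢ a)
  count<n⇔ = mk⇔ outsider (λ (z , νz≢a) → subst (count ν a <_) (length-tabulate {n = n} (λ x → x))
    (filter-notAll (λ x → ν x ≟ a) (allFin n) (Any.map (λ { refl → νz≢a }) (∈-allFin z))))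
    where
    outsider : count ν a < n → ∃[ z ] ν z ≢ a
    outsider c<n with all? (λ z → ν z ≟ a)
    ... | no ¬all = ¬∀⟶∃¬ n (λ z → ν z ≡ a) (λ z → ν z ≟ a) ¬all
    ... | yes all = ⊥-elim (<-irrefl (trans
          (cong length (filter-all (λ x → ν x ≟ a) {xs = allFin n} (All.tabulate (λ {z} _ → all z))))
          (length-tabulate {n = n} (λ x → x))) c<n)

HasProperClass : (Fin n → Fin ℓ) → Set
HasProperClass {n} ν = ∃[ a ] (1 < count ν a × count ν a < n)

module _ (f : Fin n → Fin m) where

  ¬injective⇒collision : ¬ (∀ x y → f x ≡ f y → x ≡ y) → ∃[ x ] ∃[ y ] (x ≢ y × f x ≡ f y)
  ¬injective⇒collision ¬injective
    with ¬∀⟶∃¬ n _ (λ x → all? (λ y → (f x ≟ f y) →-dec (x ≟ y))) (λ h → ¬injective (λ x y → h x y))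
  ... | x , ¬injectiveAt-x with ¬∀⟶∃¬ n _ (λ y → (f x ≟ f y) →-dec (x ≟ y)) ¬injectiveAt-x
  ...   | y , ¬implication with f x ≟ f y
  ...     | yes same = x , y , (λ x≡y → ¬implication (λ _ → x≡y)) , same
  ...     | no  diff = ⊥-elim (¬implication (⊥-elim ∘ diff))

  ¬constant⇒avoids : ¬ (∀ x y → f x ≡ f y) → ∀ a → ∃[ z ] f z ≢ a
  ¬constant⇒avoids ¬constant a
    with ¬∀⟶∃¬ n _ (λ x → all? (λ y → f x ≟ f y)) (λ h → ¬constant (λ x y → h x y))
  ... | x , ¬constantAt-x with ¬∀⟶∃¬ n _ (λ y → f x ≟ f y) ¬constantAt-x
  ...   | y , fx≢fy with f x ≟ a
  ...     | yes fx≡a = y , (λ fy≡a → fx≢fy (trans fx≡a (sym fy≡a)))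
  ...     | no  fx≢a = x , fx≢a

nontrivial⇒hasProperClass : (P : SetPartition n) → Nontrivial P → HasProperClass P
nontrivial⇒hasProperClass P (¬oneBlock , ¬singletons) with ¬injective⇒collision P ¬singletons
... | x , y , x≢y , same with ¬constant⇒avoids P ¬oneBlock (P x)
...   | z , Pz≢Px = P x , Equivalence.from (1<count⇔ P (P x)) (x , y , x≢y , refl , sym same)
                        , Equivalence.from (count<n⇔ P (P x)) (z , Pz≢Px)

EdgeColorRegular : ∀ {k} → EdgeColoredGraph n k → (Fin n → Fin ℓ) → Set
EdgeColorRegular {n} {ℓ} {k} G ν =
  ∀ (a c : Fin ℓ) (b : Fin k) → a ≢ c →
    (∃[ u ] ∃[ v ] (ν u ≡ a × ν v ≡ c × col u v ≡ just b)) →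
    ∀ u → ν u ≡ a → ∃[ v ] (ν v ≡ c × col u v ≡ just b)
  where open EdgeColoredGraph G

module _ {k} (G : EdgeColoredGraph n k) where

  τ∈coloringGroup : ∀ b → InColoringGroup G (τ G b)
  τ∈coloringGroup b = (b , false) ∷ [] , λ _ → refl

  -- The b-neighbour of u is τ_b u, which lies in the block of τ_b u₀ = v₀.
  fixed⇒edgeColorRegular : (P : SetPartition n) → (∀ g → InColoringGroup G g → Fixes g P) →
                           EdgeColorRegular G P
  fixed⇒edgeColorRegular P fixed a c b a≢c (u₀ , v₀ , Pu₀ , Pv₀ , edge) u Pu =
    τb u , Pτu , τ-moved (λ τu≡u → a≢c (trans (sym Pu) (trans (cong P (sym τu≡u)) Pτu)))
    where
    open ColorClass G b
    Pτu : P (τb u) ≡ c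
    Pτu = trans (Equivalence.to (fixed (τ G b) (τ∈coloringGroup b) u u₀) (trans Pu (sym Pu₀)))
                (trans (cong P (τ-along-edge edge)) Pv₀)

FixesFibres : {A : Set} → Permutation′ n → (Fin n → A) → Set
FixesFibres g ν = ∀ x y → ν x ≡ ν y ⇔ ν (g ⟨$⟩ʳ x) ≡ ν (g ⟨$⟩ʳ y)

module _ {A : Set} (ν : Fin n → A) where

  fixesFibres-id : FixesFibres id ν
  fixesFibres-id x y = ⇔.refl

  fixesFibres-∘ : ∀ {g h} → FixesFibres g ν → FixesFibres h ν → FixesFibres (g ∘ₚ h) ν
  fixesFibres-∘ fixes-g fixes-h x y = ⇔.trans (fixes-g x y) (fixes-h _ _)

  fixesFibres-flip : ∀ {g} → FixesFibres g ν → FixesFibres (flip g) ν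
  fixesFibres-flip {g} fixes-g x y = ⇔.sym (subst₂ (λ u v → ν (g ⟨$⟩ˡ x) ≡ ν (g ⟨$⟩ˡ y) ⇔ ν u ≡ ν v)
                                                  (inverseʳ g) (inverseʳ g) (fixes-g _ _))

  fixesFibres-≗ : ∀ {g h} → (∀ x → g ⟨$⟩ʳ x ≡ h ⟨$⟩ʳ x) → FixesFibres h ν → FixesFibres g ν
  fixesFibres-≗ g≗h fixes-h x y = subst₂ (λ u v → ν x ≡ ν y ⇔ ν u ≡ ν v)
                                         (sym (g≗h x)) (sym (g≗h y)) (fixes-h x y)

module _ (ν : Fin n → Fin ℓ) where

  chooseFromClass : ∀ c → ∃[ y ] ν y ≡ c → ∃[ y ] ν y ≡ c
  chooseFromClass c inhabited with any? (λ y → ν y ≟ c)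
  ... | yes found = found
  ... | no  none  = ⊥-elim (none inhabited)

  chooseFromClass-canonical : ∀ {c c′} h h′ → c ≡ c′ →
                              proj₁ (chooseFromClass c h) ≡ proj₁ (chooseFromClass c′ h′)
  chooseFromClass-canonical {c} h _ refl with any? (λ y → ν y ≟ c)
  ... | yes _    = refl
  ... | no  none = ⊥-elim (none h)

  -- Blocks of a SetPartition are labelled by vertices, so each color is
  -- replaced by a canonically chosen vertex of that color.
  classRep : SetPartition n
  classRep x = proj₁ (chooseFromClass (ν x) (x , refl))

  sameBlock-classRep : ∀ x y → SameBlock classRep x y ⇔ ν x ≡ ν y
  sameBlock-classRep x y = mk⇔ (λ same → trans (sym (rep-color x)) (trans (cong ν same) (rep-color y)))
                               (chooseFromClass-canonical _ _)
    where
    rep-color : ∀ x → ν (classRep x) ≡ ν x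
    rep-color x = proj₂ (chooseFromClass (ν x) (x , refl))

  fixesFibres⇒fixes-classRep : ∀ {g} → FixesFibres g ν → Fixes g classRep
  fixesFibres⇒fixes-classRep fixes x y =
    ⇔.trans (sameBlock-classRep x y) (⇔.trans (fixes x y) (⇔.sym (sameBlock-classRep _ _)))

  hasProperClass⇒nontrivial : HasProperClass ν → Nontrivial classRep
  hasProperClass⇒nontrivial (a , 1<c , c<n) = ¬oneBlock , ¬singletons
    where
    ¬singletons : ¬ (∀ x y → SameBlock classRep x y → x ≡ y)
    ¬singletons singletons with Equivalence.to (1<count⇔ ν a) 1<c
    ... | x , y , x≢y , νx , νy =
      x≢y (singletons x y (Equivalence.from (sameBlock-classRep x y) (trans νx (sym νy))))
    ¬oneBlock : ¬ (∀ x y → SameBlock classRep x y)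
    ¬oneBlock oneBlock with Equivalence.to (1<count⇔ ν a) 1<c | Equivalence.to (count<n⇔ ν a) c<n
    ... | x , _ , _ , νx , _ | z , νz≢a =
      νz≢a (trans (sym (Equivalence.to (sameBlock-classRep x z) (oneBlock x z))) νx)

module _ {k} (G : EdgeColoredGraph n k) (ν : Fin n → Fin ℓ) (regular : EdgeColorRegular G ν) where

  τ-fixesFibres : ∀ b → FixesFibres (τ G b) ν
  τ-fixesFibres b x y =
    mk⇔ keeps (λ same → subst₂ (λ u v → ν u ≡ ν v) (τ-involutive x) (τ-involutive y) (keeps same))
    where
    open ColorClass G b
    leaving : ∀ {x y} → ν x ≡ ν y → ν (τb x) ≢ ν x → ν (τb x) ≡ ν (τb y)
    leaving {x} {y} same leaves
      with regular (ν x) (ν (τb x)) b (leaves ∘ sym)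
                   (x , τb x , refl , refl , τ-moved (leaves ∘ cong ν)) y (sym same)
    ... | v , νv , edge = sym (trans (cong ν (τ-along-edge edge)) νv)
    keeps : ∀ {x y} → ν x ≡ ν y → ν (τb x) ≡ ν (τb y)
    keeps {x} {y} same with ν (τb x) ≟ ν x | ν (τb y) ≟ ν y
    ... | no  leaves | _          = leaving same leaves
    ... | yes _      | no  leaves = sym (leaving (sym same) leaves)
    ... | yes stays  | yes stays′ = trans stays (trans same (sym stays′))

  evalWord-fixesFibres : ∀ w → FixesFibres (evalWord G w) ν
  evalWord-fixesFibres []                = fixesFibres-id ν
  evalWord-fixesFibres ((b , false) ∷ w) =
    fixesFibres-∘ ν {τ G b} {evalWord G w} (τ-fixesFibres b) (evalWord-fixesFibres w)
  evalWord-fixesFibres ((b , true) ∷ w)  =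
    fixesFibres-∘ ν {flip (τ G b)} {evalWord G w}
      (fixesFibres-flip ν {τ G b} (τ-fixesFibres b)) (evalWord-fixesFibres w)

  coloringGroup-fixesFibres : ∀ g → InColoringGroup G g → FixesFibres g ν
  coloringGroup-fixesFibres g (w , g≗w) = fixesFibres-≗ ν {g} {evalWord G w} g≗w (evalWord-fixesFibres w)

lemma3p6 : (n k : ℕ) (G : EdgeColoredGraph n k) →
    Imprimitive (InColoringGroup G) ⇔ Σ ℕ (λ ℓ → Σ (Fin n → Fin ℓ) (λ ν → IsImprimitiveVertexColoring G ℓ ν))
lemma3p6 n k G = mk⇔ toColoring toPartition
  where
  toColoring : Imprimitive (InColoringGroup G) →
               Σ ℕ (λ ℓ → Σ (Fin n → Fin ℓ) (λ ν → IsImprimitiveVertexColoring G ℓ ν))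
  toColoring (P , nontrivial , fixed) =
    n , P , fixed⇒edgeColorRegular G P fixed , nontrivial⇒hasProperClass P nontrivial
  toPartition : Σ ℕ (λ ℓ → Σ (Fin n → Fin ℓ) (λ ν → IsImprimitiveVertexColoring G ℓ ν)) →
                Imprimitive (InColoringGroup G)
  toPartition (ℓ , ν , regular , properClass) =
    classRep ν , hasProperClass⇒nontrivial ν properClass ,
    λ g g∈ → fixesFibres⇒fixes-classRep ν {g} (coloringGroup-fixesFibres G ν regular g g∈)
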